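{- Let $r>3$ and $m\ge2$ be integers, let $a,d\ge0$ and $b,c\ge1$ be integers, and set $b'=\min\{b,c\}$. If $(r-2)^{m-2}\ge2(\max\{b,c\}-1)$, then \[\operatorname{forb}\big(m,r,F(a,b,c,d)\big)=\operatorname{forb}\big(m,r,F(a,b',b',d)\big).\]
   Context: An $r$-matrix is a matrix with entries in $\{0,1,\dots,r-1\}$. A matrix is simple if it has no repeated columns. For matrices $F$ and $A$, $A$ avoids $F$ if no submatrix of $A$ is a row and column permutation of $F$. $\operatorname{forb}(m,r,F)$ is the maximum number of columns of a simple $m$-rowed $r$-matrix that avoids $F$. $F(a,b,c,d)$ is the $2$-rowed $(0,1)$-matrix with $a$ columns $\left[\begin{smallmatrix}0\\0\end{smallmatrix}\right]$, $b$ columns $\left[\begin{smallmatrix}1\\0\end{smallmatrix}\right]$, $c$ columns $\left[\begin{smallmatrix}0\\1\end{smallmatrix}\right]$ and $d$ columns $\left[\begin{smallmatrix}1\\1\end{smallmatrix}\right]$. -}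

module Defs where

open import Data.Nat using (ℕ; _≤_)
open import Data.Fin using (Fin; zero; suc; toℕ)
open import Data.Vec using (Vec; replicate; _++_; lookup)
open import Data.Product using (Σ; _×_; _,_; proj₁; proj₂)
open import Relation.Nullary using (¬_)
open import Relation.Binary.PropositionalEquality using (_≡_)
open import Function.Definitions using (Injective)

Matrix : ℕ → ℕ → ℕ → Set
Matrix m n r = Fin m → Fin n → Fin r

Simple : ∀ {m n r} → Matrix m n r → Set
Simple {m} {n} A = ∀ (j j′ : Fin n) → (∀ (i : Fin m) → A i j ≡ A i j′) → j ≡ j′

-- A contains the configuration F (a p×q matrix with natural-number entries):
-- some submatrix of A (chosen rows σ, chosen columns τ, in any order, i.e.
-- a row and column permutation) equals F.
Contains : ∀ {m n r p q} → Matrix m n r → (Fin p → Fin q → ℕ) → Set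
Contains {m} {n} {r} {p} {q} A F =
  Σ (Fin p → Fin m) λ σ → Σ (Fin q → Fin n) λ τ →
    Injective _≡_ _≡_ σ × Injective _≡_ _≡_ τ ×
    (∀ i j → toℕ (A (σ i) (τ j)) ≡ F i j)

Avoids : ∀ {m n r p q} → Matrix m n r → (Fin p → Fin q → ℕ) → Set
Avoids A F = ¬ Contains A F

IsForb : ℕ → ℕ → ∀ {p q} → (Fin p → Fin q → ℕ) → ℕ → Set
IsForb m r F N =
  (Σ (Matrix m N r) λ A → Simple A × Avoids A F) ×
  (∀ n (A : Matrix m n r) → Simple A → Avoids A F → n ≤ N)

Fcols : (a b c d : ℕ) → Vec (ℕ × ℕ) (a Data.Nat.+ (b Data.Nat.+ (c Data.Nat.+ d)))
Fcols a b c d =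
  replicate a (0 , 0) ++ replicate b (1 , 0) ++ replicate c (0 , 1) ++ replicate d (1 , 1)

Fmat : (a b c d : ℕ) → Fin 2 → Fin (a Data.Nat.+ (b Data.Nat.+ (c Data.Nat.+ d))) → ℕ
Fmat a b c d zero j = proj₁ (lookup (Fcols a b c d) j)
Fmat a b c d (suc _) j = proj₂ (lookup (Fcols a b c d) j)

module Submission where

open import Defs
open import Data.Nat using (ℕ; _≤_; _<_; _≥_; _*_; _∸_; _^_; _⊔_; _⊓_)
open import Function.Bundles using (_⇔_; mk⇔)

open import Level using (0ℓ)
open import Data.Nat using (zero; suc; _+_; z≤n; s≤s)
import Data.Nat.Properties as ℕ
open import Data.Nat.Properties
  using (+-monoʳ-<; +-mono-≤; +-cancelˡ-≡; +-identityʳ; 0≢1+n; ∸-monoˡ-≤; ≮⇒≥;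
         ≤-total; ≤-refl; ⊓-glb; m≤m⊔n; m≤n⊔m; m⊓n≤m; m⊓n≤n; module ≤-Reasoning)
open import Data.Fin as Fin
  using (Fin; zero; suc; toℕ; fromℕ<; inject≤; splitAt; join; _↑ˡ_; _↑ʳ_; punchOut; finToFun; funToFin; combine)
open import Data.Fin.Properties
  using (suc-injective; inject≤-injective; ↑ˡ-injective; ↑ʳ-injective; join-splitAt; punchIn-punchOut;
         funToFin-finToFin; fromℕ<-injective; any?; <-cmp; <-asym; <-irrefl; <⇒≢; <-irrelevant)
open import Data.Fin.Permutation using (Permutation′; insert; id; _⟨$⟩ʳ_; _⟨$⟩ˡ_; inverseˡ; inverseʳ)
open import Data.Vec using (Vec; lookup; replicate; _++_)
open import Data.Vec.Properties using (lookup-replicate; lookup-++ˡ; lookup-++ʳ; lookup-splitAt)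
open import Data.Vec.Relation.Unary.All using (All; []; _∷_)
open import Data.Vec.Relation.Unary.All.Properties using (lookup⁺; ++⁺)
open import Data.Product using (Σ; Σ-syntax; ∃₂; _×_; _,_; proj₁; proj₂; swap)
open import Data.Product.Properties using (≡-dec; ,-injectiveˡ; ,-injectiveʳ)
open import Data.Sum using (_⊎_; inj₁; inj₂; [_,_]; [_,_]′)
open import Data.Empty using (⊥-elim)
open import Function using (_∘_)
open import Function.Definitions using (Injective)
open import Relation.Nullary using (¬_; Dec; yes; no)
open import Relation.Nullary.Decidable using (_×-dec_; _⊎-dec_)
open import Relation.Unary using (Pred; Decidable; _⊆_; _∪_)
open import Relation.Unary.Properties using (_∪?_)
open import Relation.Binary using (tri<; tri≈; tri>)
open import Relation.Binary.PropositionalEquality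
open import Algebra.Properties.CommutativeSemigroup ℕ.+-commutativeSemigroup using (interchange)

-- Write q = r - 2, L = m - 2, B = min(b,c) and C = max(b,c).  F(a,b,c,d) contains
-- F(a,B,B,d), so avoiding the latter avoids the former; the content is the converse
-- trade: a simple (L+2)-rowed (q+2)-matrix A avoiding F(a,b,c,d) becomes a simple
-- matrix A′ with as many columns avoiding F(a,B,B,d).  A pair of rows i < j is
-- deficient if fewer than C columns show [0;1] and fewer than C show [1;0] on it.
-- Each column mixed ([0;1] or [1;0]) on a deficient pair (i,j) is replaced by a
-- marker: 1 in row i, 0 in row j, and entries ≥ 2 elsewhere encoding its rank among
-- the < 2(C-1) ≤ q^L mixed columns of (i,j); so A′ stays simple.  In A′ no column
-- shows [0;1] on a deficient pair, and on every other pair u < v A′ has the 0/1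
-- patterns of A, where C columns of one mixed pattern complete F(a,B,B,d) to
-- F(a,b,c,d).

indicator : ∀ {A : Set} → Dec A → ℕ
indicator (yes _) = 1
indicator (no _)  = 0

indicator-yes : ∀ {A : Set} (a? : Dec A) → A → indicator a? ≡ 1
indicator-yes (yes _) _ = refl
indicator-yes (no ¬a) a = ⊥-elim (¬a a)

indicator-∪ : ∀ {A B : Set} (a? : Dec A) (b? : Dec B) → indicator (a? ⊎-dec b?) ≤ indicator a? + indicator b?
indicator-∪ (yes _) _       = s≤s z≤n
indicator-∪ (no _)  (yes _) = s≤s z≤n
indicator-∪ (no _)  (no _)  = z≤n

count : ∀ {n} {P : Pred (Fin n) 0ℓ} → Decidable P → ℕ
count {zero}  P? = 0
count {suc n} P? = indicator (P? zero) + count (P? ∘ suc)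

rank : ∀ {n} {P : Pred (Fin n) 0ℓ} → Decidable P → Fin n → ℕ
rank P? zero    = 0
rank P? (suc k) = indicator (P? zero) + rank (P? ∘ suc) k

rank<count : ∀ {n} {P : Pred (Fin n) 0ℓ} (P? : Decidable P) {k} → P k → rank P? k < count P?
rank<count P? {zero}  pk =
  subst (λ x → 0 < x + count (P? ∘ suc)) (sym (indicator-yes (P? zero) pk)) (s≤s z≤n)
rank<count P? {suc k} pk = +-monoʳ-< (indicator (P? zero)) (rank<count (P? ∘ suc) pk)

rank-injective : ∀ {n} {P : Pred (Fin n) 0ℓ} (P? : Decidable P) {k k'} →
  P k → P k' → rank P? k ≡ rank P? k' → k ≡ k'
rank-injective P? {zero}  {zero}   _  _   _ = refl
rank-injective P? {zero}  {suc k'} pk _   e =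
  ⊥-elim (0≢1+n (trans e (cong (_+ rank (P? ∘ suc) k') (indicator-yes (P? zero) pk))))
rank-injective P? {suc k} {zero}   _  pk' e =
  ⊥-elim (0≢1+n (trans (sym e) (cong (_+ rank (P? ∘ suc) k) (indicator-yes (P? zero) pk'))))
rank-injective P? {suc k} {suc k'} pk pk' e =
  cong suc (rank-injective (P? ∘ suc) pk pk' (+-cancelˡ-≡ (indicator (P? zero)) _ _ e))

count-∪ : ∀ {n} {P Q : Pred (Fin n) 0ℓ} (P? : Decidable P) (Q? : Decidable Q) →
  count (P? ∪? Q?) ≤ count P? + count Q?
count-∪ {zero}  P? Q? = z≤n
count-∪ {suc n} P? Q? = begin
  indicator ((P? ∪? Q?) zero) + count ((P? ∪? Q?) ∘ suc)
    ≤⟨ +-mono-≤ (indicator-∪ (P? zero) (Q? zero)) (count-∪ (P? ∘ suc) (Q? ∘ suc)) ⟩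
  (indicator (P? zero) + indicator (Q? zero)) + (count (P? ∘ suc) + count (Q? ∘ suc))
    ≡⟨ interchange (indicator (P? zero)) (indicator (Q? zero)) _ _ ⟩
  count P? + count Q?
    ∎
  where open ≤-Reasoning

record Distinct {n} (c : ℕ) (P : Pred (Fin n) 0ℓ) : Set where
  constructor distinct
  field
    index     : Fin c → Fin n
    injective : Injective _≡_ _≡_ index
    satisfies : ∀ x → P (index x)

distinct-map : ∀ {n c} {P Q : Pred (Fin n) 0ℓ} → P ⊆ Q → Distinct c P → Distinct c Q
distinct-map P⊆Q (distinct g g-inj g-P) = distinct g g-inj (P⊆Q ∘ g-P)

distinct-shrink : ∀ {n c c'} {P : Pred (Fin n) 0ℓ} → c' ≤ c → Distinct c P → Distinct c' P
distinct-shrink c'≤c (distinct g g-inj g-P) =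
  distinct (g ∘ embed) (inject≤-injective c'≤c c'≤c _ _ ∘ g-inj) (g-P ∘ embed)
  where embed = λ x → inject≤ x c'≤c

distinct-none : ∀ {n} {P : Pred (Fin n) 0ℓ} → Distinct 0 P
distinct-none = distinct (λ ()) (λ { {()} }) (λ ())

distinct-cons : ∀ {n c} {P : Pred (Fin (suc n)) 0ℓ} → P zero → Distinct c (P ∘ suc) → Distinct (suc c) P
distinct-cons {P = P} p0 (distinct g g-inj g-P) = distinct h h-inj h-P
  where
  h : Fin (suc _) → Fin (suc _)
  h zero    = zero
  h (suc x) = suc (g x)
  h-inj : Injective _≡_ _≡_ h
  h-inj {zero}  {zero}  _ = refl
  h-inj {zero}  {suc _} ()
  h-inj {suc _} {zero}  ()
  h-inj {suc x} {suc y} e = cong suc (g-inj (suc-injective e))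
  h-P : ∀ x → P (h x)
  h-P zero    = p0
  h-P (suc x) = g-P x

distinct-suc : ∀ {n c} {P : Pred (Fin (suc n)) 0ℓ} → Distinct c (P ∘ suc) → Distinct c P
distinct-suc (distinct g g-inj g-P) = distinct (suc ∘ g) (g-inj ∘ suc-injective) g-P

select : ∀ {n c} {P : Pred (Fin n) 0ℓ} (P? : Decidable P) → c ≤ count P? → Distinct c P
select {zero}  {zero}  {P = P} P? _ = distinct-none {P = P}
select {suc n} {c}     {P = P} P? c≤count with P? zero
... | no _ = distinct-suc {P = P} (select (P? ∘ suc) c≤count)
select {suc n} {zero}  {P = P} P? _        | yes _  = distinct-none {P = P}
select {suc n} {suc c} {P = P} P? (s≤s c≤) | yes p0 = distinct-cons {P = P} p0 (select (P? ∘ suc) c≤)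

entries : ∀ {m n r} → Matrix m n r → Fin m → Fin m → Fin n → ℕ × ℕ
entries A i j k = toℕ (A i k) , toℕ (A j k)

HasPattern : ∀ {m n r} → Matrix m n r → Fin m → Fin m → ℕ × ℕ → Pred (Fin n) 0ℓ
HasPattern A i j pq k = entries A i j k ≡ pq

hasPattern? : ∀ {m n r} (A : Matrix m n r) i j pq → Decidable (HasPattern A i j pq)
hasPattern? A i j pq k = ≡-dec ℕ._≟_ ℕ._≟_ (entries A i j k) pq

pattern-swap : ∀ {m n r} (A : Matrix m n r) {i j pq} → HasPattern A i j pq ⊆ HasPattern A j i (swap pq)
pattern-swap A = cong swap

Realises : ∀ {m n r N} → Matrix m n r → Fin m → Fin m → Vec (ℕ × ℕ) N → Set
Realises {n = n} {N = N} A i j v =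
  Σ (Fin N → Fin n) λ τ → Injective _≡_ _≡_ τ × (∀ t → HasPattern A i j (lookup v t) (τ t))

module _ {m n r} (A : Matrix m n r) {i j : Fin m} where

  realise-replicate : ∀ {c pq} → Distinct c (HasPattern A i j pq) → Realises A i j (replicate c pq)
  realise-replicate {pq = pq} (distinct g g-inj g-pat) =
    g , g-inj , λ t → subst (λ x → HasPattern A i j x (g t)) (sym (lookup-replicate t pq)) (g-pat t)

  unrealise-replicate : ∀ {c pq} → Realises A i j (replicate c pq) → Distinct c (HasPattern A i j pq)
  unrealise-replicate {pq = pq} (τ , τ-inj , τ-pat) =
    distinct τ τ-inj λ t → subst (λ x → HasPattern A i j x (τ t)) (lookup-replicate t pq) (τ-pat t)

  -- Realisations of u and w whose patterns never coincide glue to one of u ++ w;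
  -- the glued columns are distinct because a column shows only one pattern.
  realise-++ : ∀ {N₁ N₂} (u : Vec (ℕ × ℕ) N₁) (w : Vec (ℕ × ℕ) N₂) →
    Realises A i j u → Realises A i j w → (∀ s t → lookup u s ≢ lookup w t) → Realises A i j (u ++ w)
  realise-++ {N₁} {N₂} u w (τu , τu-inj , τu-pat) (τw , τw-inj , τw-pat) apart =
    τ , split-injective ∘ glue-injective , pat
    where
    τ : Fin (N₁ + N₂) → Fin n
    τ = [ τu , τw ]′ ∘ splitAt N₁

    split-injective : ∀ {x y} → splitAt N₁ x ≡ splitAt N₁ y → x ≡ y
    split-injective {x} {y} e =
      trans (sym (join-splitAt N₁ N₂ x)) (trans (cong (join N₁ N₂) e) (join-splitAt N₁ N₂ y))

    glue-injective : ∀ {x y : Fin N₁ ⊎ Fin N₂} → [ τu , τw ]′ x ≡ [ τu , τw ]′ y → x ≡ y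
    glue-injective {inj₁ x} {inj₁ y} e = cong inj₁ (τu-inj e)
    glue-injective {inj₁ x} {inj₂ y} e =
      ⊥-elim (apart x y (trans (sym (τu-pat x)) (trans (cong (entries A i j) e) (τw-pat y))))
    glue-injective {inj₂ x} {inj₁ y} e =
      ⊥-elim (apart y x (trans (sym (τu-pat y)) (trans (cong (entries A i j) (sym e)) (τw-pat x))))
    glue-injective {inj₂ x} {inj₂ y} e = cong inj₂ (τw-inj e)

    pat : ∀ t → HasPattern A i j (lookup (u ++ w) t) (τ t)
    pat t = subst (λ x → HasPattern A i j x (τ t)) (sym (lookup-splitAt N₁ u w t))
      ([_,_] {C = λ s → HasPattern A i j ([ lookup u , lookup w ]′ s) ([ τu , τw ]′ s)} τu-pat τw-pat (splitAt N₁ t))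

  unrealise-++ : ∀ {N₁ N₂} (u : Vec (ℕ × ℕ) N₁) (w : Vec (ℕ × ℕ) N₂) →
    Realises A i j (u ++ w) → Realises A i j u × Realises A i j w
  unrealise-++ {N₁} {N₂} u w (τ , τ-inj , τ-pat) =
    (τ ∘ (_↑ˡ N₂) , ↑ˡ-injective N₂ _ _ ∘ τ-inj ,
      λ s → subst (λ x → HasPattern A i j x (τ (s ↑ˡ N₂))) (lookup-++ˡ u w s) (τ-pat (s ↑ˡ N₂))) ,
    (τ ∘ (N₁ ↑ʳ_) , ↑ʳ-injective N₁ _ _ ∘ τ-inj ,
      λ t → subst (λ x → HasPattern A i j x (τ (N₁ ↑ʳ t))) (lookup-++ʳ u w t) (τ-pat (N₁ ↑ʳ t)))

  realise-block : ∀ {c pq N} {w : Vec (ℕ × ℕ) N} →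
    Distinct c (HasPattern A i j pq) → All (_≢ pq) w → Realises A i j w → Realises A i j (replicate c pq ++ w)
  realise-block {c} {pq} {w = w} block w≢pq realised =
    realise-++ (replicate c pq) w (realise-replicate block) realised
      λ s t e → lookup⁺ w≢pq t (trans (sym e) (lookup-replicate s pq))

all-replicate : ∀ {A : Set} {P : A → Set} {x} n → P x → All P (replicate n x)
all-replicate zero    _  = []
all-replicate (suc n) px = px ∷ all-replicate n px

record FBlocks {m n r} (A : Matrix m n r) (i j : Fin m) (a b c d : ℕ) : Set where
  constructor fblocks
  field
    block00 : Distinct a (HasPattern A i j (0 , 0))
    block10 : Distinct b (HasPattern A i j (1 , 0))
    block01 : Distinct c (HasPattern A i j (0 , 1))
    block11 : Distinct d (HasPattern A i j (1 , 1))

module _ {m n r} (A : Matrix m n r) {a b c d : ℕ} where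

  contains⇒blocks : Contains A (Fmat a b c d) → Σ[ i ∈ Fin m ] Σ[ j ∈ Fin m ] i ≢ j × FBlocks A i j a b c d
  contains⇒blocks (σ , τ , σ-inj , τ-inj , στ-entries) =
    σ zero , σ (suc zero) , (λ e → zero≢one (σ-inj e)) ,
    fblocks (unrealise-replicate A (proj₁ split00)) (unrealise-replicate A (proj₁ split10))
            (unrealise-replicate A (proj₁ split01)) (unrealise-replicate A (proj₂ split01))
    where
    zero≢one : zero ≢ suc zero
    zero≢one ()
    realised : Realises A (σ zero) (σ (suc zero)) (Fcols a b c d)
    realised = τ , τ-inj , λ t → cong₂ _,_ (στ-entries zero t) (στ-entries (suc zero) t)
    split00 = unrealise-++ A (replicate a (0 , 0)) _ realised
    split10 = unrealise-++ A (replicate b (1 , 0)) _ (proj₂ split00)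
    split01 = unrealise-++ A (replicate c (0 , 1)) _ (proj₂ split10)

  blocks⇒contains : ∀ {i j} → i ≢ j → FBlocks A i j a b c d → Contains A (Fmat a b c d)
  blocks⇒contains {i} {j} i≢j (fblocks B00 B10 B01 B11) = σ , τ , σ-inj , τ-inj , στ-entries
    where
    realised : Realises A i j (Fcols a b c d)
    realised =
      realise-block A B00 (++⁺ (all-replicate b λ ()) (++⁺ (all-replicate c λ ()) (all-replicate d λ ()))) (
      realise-block A B10 (++⁺ (all-replicate c λ ()) (all-replicate d λ ())) (
      realise-block A B01 (all-replicate d λ ()) (
      realise-replicate A B11)))
    τ = proj₁ realised
    τ-inj = proj₁ (proj₂ realised)
    σ : Fin 2 → Fin m
    σ zero    = i
    σ (suc _) = j
    σ-inj : Injective _≡_ _≡_ σ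
    σ-inj {zero}     {zero}     _ = refl
    σ-inj {zero}     {suc zero} e = ⊥-elim (i≢j e)
    σ-inj {suc zero} {zero}     e = ⊥-elim (i≢j (sym e))
    σ-inj {suc zero} {suc zero} _ = refl
    στ-entries : ∀ x t → toℕ (A (σ x) (τ t)) ≡ Fmat a b c d x t
    στ-entries zero       t = cong proj₁ (proj₂ (proj₂ realised) t)
    στ-entries (suc zero) t = cong proj₂ (proj₂ (proj₂ realised) t)

module _ {m n r} {A : Matrix m n r} {i j : Fin m} where

  blocks-swap : ∀ {a b c d} → FBlocks A i j a b c d → FBlocks A j i a c b d
  blocks-swap (fblocks B00 B10 B01 B11) =
    fblocks (distinct-map (pattern-swap A) B00) (distinct-map (pattern-swap A) B01)
            (distinct-map (pattern-swap A) B10) (distinct-map (pattern-swap A) B11)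

  blocks-shrink : ∀ {a b c d b' c'} → b' ≤ b → c' ≤ c → FBlocks A i j a b c d → FBlocks A i j a b' c' d
  blocks-shrink b'≤b c'≤c (fblocks B00 B10 B01 B11) =
    fblocks B00 (distinct-shrink b'≤b B10) (distinct-shrink c'≤c B01) B11

  blocks-transfer : ∀ {m' r'} {B : Matrix m' n r'} {i' j' a b c d} →
    (∀ {p q} → p ≤ 1 → q ≤ 1 → HasPattern A i j (p , q) ⊆ HasPattern B i' j' (p , q)) →
    FBlocks A i j a b c d → FBlocks B i' j' a b c d
  blocks-transfer keep (fblocks B00 B10 B01 B11) =
    fblocks (distinct-map (keep z≤n z≤n) B00) (distinct-map (keep (s≤s z≤n) z≤n) B10)
            (distinct-map (keep z≤n (s≤s z≤n)) B01) (distinct-map (keep (s≤s z≤n) (s≤s z≤n)) B11)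

module _ {m n r} (A : Matrix m n r) {a b c d : ℕ} where

  avoids-min : Avoids A (Fmat a (b ⊓ c) (b ⊓ c) d) → Avoids A (Fmat a b c d)
  avoids-min avoids-smaller occurrence with contains⇒blocks A occurrence
  ... | i , j , i≢j , copy =
    avoids-smaller (blocks⇒contains A i≢j (blocks-shrink (m⊓n≤m b c) (m⊓n≤n b c) copy))

  -- The symmetric configuration F(a,B,B,d) on (i,j) together with C columns [0;1]
  -- contains F(a,b,c,d): on (i,j) if b ≤ c, and on (j,i) otherwise.
  contains-with-wide-01 : ∀ {i j} → i ≢ j → FBlocks A i j a (b ⊓ c) (b ⊓ c) d →
    Distinct (b ⊔ c) (HasPattern A i j (0 , 1)) → Contains A (Fmat a b c d)
  contains-with-wide-01 i≢j (fblocks B00 B10 _ B11) wide with ≤-total b c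
  ... | inj₁ b≤c = blocks⇒contains A i≢j
          (fblocks B00 (distinct-shrink (⊓-glb ≤-refl b≤c) B10) (distinct-shrink (m≤n⊔m b c) wide) B11)
  ... | inj₂ c≤b = blocks⇒contains A (i≢j ∘ sym) (blocks-swap
          (fblocks B00 (distinct-shrink (⊓-glb c≤b ≤-refl) B10) (distinct-shrink (m≤m⊔n b c) wide) B11))

funToFin-cong : ∀ {m n} {f g : Fin m → Fin n} → (∀ x → f x ≡ g x) → funToFin f ≡ funToFin g
funToFin-cong {zero}  _ = refl
funToFin-cong {suc m} e = cong₂ combine (e zero) (funToFin-cong (λ x → e (suc x)))

finToFun-injective : ∀ {q L} {t t' : Fin (q ^ L)} → (∀ s → finToFun {q} {L} t s ≡ finToFun t' s) → t ≡ t'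
finToFun-injective {q} {L} {t} {t'} e =
  trans (sym (funToFin-finToFin {L} {q} t)) (trans (funToFin-cong {L} {q} e) (funToFin-finToFin {L} {q} t'))

-- A relabelling of the rows sending the first two rows to i and j.
frame : ∀ {L} (i j : Fin (2 + L)) → i ≢ j → Permutation′ (2 + L)
frame i j i≢j = insert zero i (insert zero (punchOut i≢j) id)

-- The relabelling of the second row (that of the first is i by computation).
frame-1 : ∀ {L} (i j : Fin (2 + L)) (i≢j : i ≢ j) → frame i j i≢j ⟨$⟩ʳ suc zero ≡ j
frame-1 i j i≢j = punchIn-punchOut i≢j

base : ∀ {L q} → (Fin L → Fin q) → Fin (2 + L) → Fin (2 + q)
base v zero          = suc zero
base v (suc zero)    = zero
base v (suc (suc s)) = suc (suc (v s))

base-one : ∀ {L q} (v : Fin L → Fin q) x → toℕ (base v x) ≡ 1 → x ≡ zero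
base-one v zero          _ = refl
base-one v (suc zero)    ()
base-one v (suc (suc s)) ()

base-zero : ∀ {L q} (v : Fin L → Fin q) x → toℕ (base v x) ≡ 0 → x ≡ suc zero
base-zero v zero          ()
base-zero v (suc zero)    _ = refl
base-zero v (suc (suc s)) ()

marker : ∀ {L q} (i j : Fin (2 + L)) → i Fin.< j → Fin (q ^ L) → Fin (2 + L) → Fin (2 + q)
marker {L} {q} i j i<j t l = base (finToFun t) (frame i j (<⇒≢ i<j) ⟨$⟩ˡ l)

module _ {L q} (i j : Fin (2 + L)) (i<j : i Fin.< j) (t : Fin (q ^ L)) where
  private
    π = frame i j (<⇒≢ i<j)

  marker-frame : ∀ x → marker i j i<j t (π ⟨$⟩ʳ x) ≡ base (finToFun t) x
  marker-frame x = cong (base (finToFun t)) (inverseˡ π)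

  marker-at-i : toℕ (marker i j i<j t i) ≡ 1
  marker-at-i = cong toℕ (marker-frame zero)

  marker-at-j : toℕ (marker i j i<j t j) ≡ 0
  marker-at-j = cong toℕ (subst (λ l → marker i j i<j t l ≡ zero) (frame-1 i j (<⇒≢ i<j)) (marker-frame (suc zero)))

  marker-one : ∀ l → toℕ (marker i j i<j t l) ≡ 1 → l ≡ i
  marker-one l e = begin
    l                 ≡⟨ inverseʳ π ⟨
    π ⟨$⟩ʳ (π ⟨$⟩ˡ l)  ≡⟨ cong (π ⟨$⟩ʳ_) (base-one (finToFun t) _ e) ⟩
    π ⟨$⟩ʳ zero        ≡⟨⟩
    i                 ∎
    where open ≡-Reasoning

  marker-zero : ∀ l → toℕ (marker i j i<j t l) ≡ 0 → l ≡ j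
  marker-zero l e = begin
    l                 ≡⟨ inverseʳ π ⟨
    π ⟨$⟩ʳ (π ⟨$⟩ˡ l)  ≡⟨ cong (π ⟨$⟩ʳ_) (base-zero (finToFun t) _ e) ⟩
    π ⟨$⟩ʳ suc zero    ≡⟨ frame-1 i j (<⇒≢ i<j) ⟩
    j                 ∎
    where open ≡-Reasoning

  marker-binary : ∀ l {p} → p ≤ 1 → toℕ (marker i j i<j t l) ≡ p → l ≡ i ⊎ l ≡ j
  marker-binary l z≤n       e = inj₂ (marker-zero l e)
  marker-binary l (s≤s z≤n) e = inj₁ (marker-one l e)

marker-code-injective : ∀ {L q} (i j : Fin (2 + L)) (i<j : i Fin.< j) {t t' : Fin (q ^ L)} →
  (∀ l → marker i j i<j t l ≡ marker i j i<j t' l) → t ≡ t'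
marker-code-injective i j i<j {t} {t'} e = finToFun-injective λ s → suc-injective (suc-injective (begin
  suc (suc (finToFun t s))                ≡⟨ marker-frame i j i<j t (suc (suc s)) ⟨
  marker i j i<j t (π ⟨$⟩ʳ suc (suc s))   ≡⟨ e _ ⟩
  marker i j i<j t' (π ⟨$⟩ʳ suc (suc s))  ≡⟨ marker-frame i j i<j t' (suc (suc s)) ⟩
  suc (suc (finToFun t' s))               ∎))
  where
  open ≡-Reasoning
  π = frame i j (<⇒≢ i<j)

-- A marker determines its pair (the rows of its 1 and its 0) and its code.
marker-injective : ∀ {L q} {i j i' j' : Fin (2 + L)} (i<j : i Fin.< j) (i'<j' : i' Fin.< j') {t t' : Fin (q ^ L)} →
  (∀ l → marker i j i<j t l ≡ marker i' j' i'<j' t' l) → i ≡ i' × j ≡ j' × t ≡ t'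
marker-injective {i = i} {j} {i'} {j'} i<j i'<j' {t} {t'} e
  with marker-one i' j' i'<j' t' i (trans (cong toℕ (sym (e i))) (marker-at-i i j i<j t))
     | marker-zero i' j' i'<j' t' j (trans (cong toℕ (sym (e j))) (marker-at-j i j i<j t))
... | refl | refl = refl , refl , marker-code-injective i j i<j λ l →
  trans (e l) (cong (λ p → marker i j p t' l) (<-irrelevant i'<j' i<j))

module Rewrite {q L a b c d : ℕ} (1≤b⊓c : 1 ≤ b ⊓ c) (room : 2 * ((b ⊔ c) ∸ 1) ≤ q ^ L)
  {n} (A : Matrix (2 + L) n (2 + q)) (A-simple : Simple A) (A-avoids : Avoids A (Fmat a b c d)) where

  Row : Set
  Row = Fin (2 + L)

  #01 #10 : Row → Row → ℕ
  #01 i j = count (hasPattern? A i j (0 , 1))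
  #10 i j = count (hasPattern? A i j (1 , 0))

  Mixed : Row → Row → Pred (Fin n) 0ℓ
  Mixed i j = HasPattern A i j (0 , 1) ∪ HasPattern A i j (1 , 0)

  mixed? : ∀ i j → Decidable (Mixed i j)
  mixed? i j = hasPattern? A i j (0 , 1) ∪? hasPattern? A i j (1 , 0)

  Deficient : Row → Row → Set
  Deficient i j = i Fin.< j × #01 i j < b ⊔ c × #10 i j < b ⊔ c

  deficient? : ∀ i j → Dec (Deficient i j)
  deficient? i j = (i Fin.<? j) ×-dec (#01 i j ℕ.<? b ⊔ c) ×-dec (#10 i j ℕ.<? b ⊔ c)

  Rewritten : Pred (Fin n) 0ℓ
  Rewritten k = ∃₂ λ i j → Deficient i j × Mixed i j k

  -- Opaque: A′ is only ever inspected through the view below, and unfolding the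
  -- search over all pairs of rows would make type checking needlessly expensive.
  opaque
    rewritten? : Decidable Rewritten
    rewritten? k = any? λ i → any? λ j → deficient? i j ×-dec mixed? i j k

  -- Fewer than 2(C-1) ≤ q ^ L columns are mixed on a deficient pair, so their
  -- ranks are valid codes for markers.
  rank-bound : ∀ {i j k} → Deficient i j → Mixed i j k → rank (mixed? i j) k < q ^ L
  rank-bound {i} {j} {k} (_ , few01 , few10) mixed = begin-strict
    rank (mixed? i j) k         <⟨ rank<count (mixed? i j) mixed ⟩
    count (mixed? i j)          ≤⟨ count-∪ (hasPattern? A i j (0 , 1)) (hasPattern? A i j (1 , 0)) ⟩
    #01 i j + #10 i j           ≤⟨ +-mono-≤ (∸-monoˡ-≤ 1 few01) (∸-monoˡ-≤ 1 few10) ⟩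
    (b ⊔ c ∸ 1) + (b ⊔ c ∸ 1)   ≡⟨ cong (b ⊔ c ∸ 1 +_) (+-identityʳ _) ⟨
    2 * (b ⊔ c ∸ 1)             ≤⟨ room ⟩
    q ^ L                       ∎
    where open ≤-Reasoning

  code : ∀ {i j k} → Deficient i j → Mixed i j k → Fin (q ^ L)
  code deficient mixed = fromℕ< (rank-bound deficient mixed)

  newColumn : ∀ k → Dec (Rewritten k) → Row → Fin (2 + q)
  newColumn k (yes (i , j , deficient , mixed)) = marker i j (proj₁ deficient) (code deficient mixed)
  newColumn k (no _) l = A l k

  A′ : Matrix (2 + L) n (2 + q)
  A′ l k = newColumn k (rewritten? k) l

  data View (k : Fin n) (col : Row → Fin (2 + q)) : Set where
    kept   : ¬ Rewritten k → (∀ l → col l ≡ A l k) → View k col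
    marked : ∀ {i j} (deficient : Deficient i j) (mixed : Mixed i j k) →
             (∀ l → col l ≡ marker i j (proj₁ deficient) (code deficient mixed) l) → View k col

  view : ∀ k → View k (λ l → A′ l k)
  view k = classify (rewritten? k)
    where
    classify : (dk : Dec (Rewritten k)) → View k (newColumn k dk)
    classify (yes (i , j , deficient , mixed)) = marked deficient mixed (λ _ → refl)
    classify (no not-rewritten)               = kept not-rewritten (λ _ → refl)

  entries-via : ∀ {k} {col : Row → Fin (2 + q)} → (∀ l → A′ l k ≡ col l) →
    ∀ u v → entries A′ u v k ≡ (toℕ (col u) , toℕ (col v))
  entries-via same u v = cong₂ _,_ (cong toℕ (same u)) (cong toℕ (same v))

  -- A column of A equal to the marker of a deficient pair (i, j) shows [1;0] on
  -- (i, j), so it is mixed there and would not have been kept.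
  marker-mixed : ∀ {i j k} (i<j : i Fin.< j) t → (∀ l → A l k ≡ marker i j i<j t l) → Mixed i j k
  marker-mixed {i} {j} i<j t same =
    inj₂ (cong₂ _,_ (trans (cong toℕ (same i)) (marker-at-i i j i<j t))
                    (trans (cong toℕ (same j)) (marker-at-j i j i<j t)))

  -- Kept columns are distinct as A is simple, a kept column is no marker, and
  -- equal markers come from the same pair and rank, hence the same column.
  columns-distinct : ∀ {k k' col col'} → View k col → View k' col' → (∀ l → col l ≡ col' l) → k ≡ k'
  columns-distinct (kept _ e) (kept _ e') same =
    A-simple _ _ λ l → trans (sym (e l)) (trans (same l) (e' l))
  columns-distinct (marked deficient _ e) (kept not-rewritten e') same =
    ⊥-elim (not-rewritten (_ , _ , deficient ,
      marker-mixed (proj₁ deficient) _ λ l → trans (sym (e' l)) (trans (sym (same l)) (e l))))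
  columns-distinct (kept not-rewritten e) (marked deficient _ e') same =
    ⊥-elim (not-rewritten (_ , _ , deficient ,
      marker-mixed (proj₁ deficient) _ λ l → trans (sym (e l)) (trans (same l) (e' l))))
  columns-distinct (marked {i} {j} deficient mixed e) (marked deficient' mixed' e') same
    with marker-injective (proj₁ deficient) (proj₁ deficient') (λ l → trans (sym (e l)) (trans (same l) (e' l)))
  ... | refl , refl , same-code =
    rank-injective (mixed? i j) mixed mixed'
      (fromℕ<-injective _ _ (rank-bound deficient mixed) (rank-bound deficient' mixed') same-code)

  A′-simple : Simple A′
  A′-simple k k' = columns-distinct (view k) (view k')

  -- No column of A′ shows [0;1] on a deficient pair (u, v): a kept column would be
  -- mixed there, and a marker of (i, j) shows [0;1] only on (j, i), where i < j.
  deficient-no-01 : ∀ {u v k} → Deficient u v → ¬ HasPattern A′ u v (0 , 1) k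
  deficient-no-01 {u} {v} {k} deficient shown with view k
  ... | kept not-rewritten e =
    not-rewritten (u , v , deficient , inj₁ (trans (sym (entries-via e u v)) shown))
  ... | marked {i} {j} deficient' mixed e
    with marker-zero i j (proj₁ deficient') _ u (,-injectiveˡ (trans (sym (entries-via e u v)) shown))
       | marker-one  i j (proj₁ deficient') _ v (,-injectiveʳ (trans (sym (entries-via e u v)) shown))
  ...   | refl | refl = <-asym (proj₁ deficient) (proj₁ deficient')

  -- On an ordered pair u < v that is not deficient, A′ keeps every 0/1 pattern of A:
  -- a marker of (i, j) with 0/1 entries in rows u, v would force (u, v) = (i, j).
  pattern-kept : ∀ {u v} → u Fin.< v → ¬ Deficient u v → ∀ {p q} → p ≤ 1 → q ≤ 1 →
    HasPattern A′ u v (p , q) ⊆ HasPattern A u v (p , q)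
  pattern-kept {u} {v} u<v not-deficient p≤1 q≤1 {k} shown with view k
  ... | kept _ e = trans (sym (entries-via e u v)) shown
  ... | marked {i} {j} deficient mixed e
    with marker-binary i j (proj₁ deficient) _ u p≤1 (,-injectiveˡ (trans (sym (entries-via e u v)) shown))
       | marker-binary i j (proj₁ deficient) _ v q≤1 (,-injectiveʳ (trans (sym (entries-via e u v)) shown))
  ...   | inj₁ refl | inj₁ refl = ⊥-elim (<-irrefl refl u<v)
  ...   | inj₁ refl | inj₂ refl = ⊥-elim (not-deficient deficient)
  ...   | inj₂ refl | inj₁ refl = ⊥-elim (<-asym u<v (proj₁ deficient))
  ...   | inj₂ refl | inj₂ refl = ⊥-elim (<-irrefl refl u<v)

  wide-pattern : ∀ {u v} → u Fin.< v → ¬ Deficient u v → b ⊔ c ≤ #01 u v ⊎ b ⊔ c ≤ #10 u v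
  wide-pattern {u} {v} u<v not-deficient with #01 u v ℕ.<? b ⊔ c | #10 u v ℕ.<? b ⊔ c
  ... | yes few01 | yes few10 = ⊥-elim (not-deficient (u<v , few01 , few10))
  ... | no many01 | _         = inj₁ (≮⇒≥ many01)
  ... | yes _     | no many10 = inj₂ (≮⇒≥ many10)

  -- A copy of F(a,B,B,d) in A′ on rows u < v: a deficient pair lacks its [0;1]
  -- block, and otherwise the copy lives in A and extends to F(a,b,c,d).
  no-ordered-copy : ∀ {u v} → u Fin.< v → ¬ FBlocks A′ u v a (b ⊓ c) (b ⊓ c) d
  no-ordered-copy {u} {v} u<v copy with deficient? u v
  ... | yes deficient =
    deficient-no-01 deficient (Distinct.satisfies (FBlocks.block01 copy) (fromℕ< 1≤b⊓c))
  ... | no not-deficient with wide-pattern u<v not-deficient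
  ...   | inj₁ wide01 = A-avoids (contains-with-wide-01 A (<⇒≢ u<v)
                          (blocks-transfer (pattern-kept u<v not-deficient) copy)
                          (select _ wide01))
  ...   | inj₂ wide10 = A-avoids (contains-with-wide-01 A (<⇒≢ u<v ∘ sym)
                          (blocks-swap (blocks-transfer (pattern-kept u<v not-deficient) copy))
                          (distinct-map (pattern-swap A) (select _ wide10)))

  A′-avoids : Avoids A′ (Fmat a (b ⊓ c) (b ⊓ c) d)
  A′-avoids occurrence with contains⇒blocks A′ occurrence
  ... | x , y , x≢y , copy with <-cmp x y
  ...   | tri< x<y _ _ = no-ordered-copy x<y copy
  ...   | tri≈ _ x≡y _ = x≢y x≡y
  ...   | tri> _ _ y<x = no-ordered-copy y<x (blocks-swap copy)

isForb-⇔ : ∀ {m r p₁ q₁ p₂ q₂} {F : Fin p₁ → Fin q₁ → ℕ} {F′ : Fin p₂ → Fin q₂ → ℕ} →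
  (∀ {n} (A : Matrix m n r) → Avoids A F′ → Avoids A F) →
  (∀ {n} (A : Matrix m n r) → Simple A → Avoids A F → Σ (Matrix m n r) λ A′ → Simple A′ × Avoids A′ F′) →
  ∀ N → IsForb m r F N ⇔ IsForb m r F′ N
isForb-⇔ {m} {r} {F = F} {F′} weaker trade N = mk⇔ to from
  where
  to : IsForb m r F N → IsForb m r F′ N
  to ((A , simple , avoids) , bound) =
    trade A simple avoids , λ n A′ simple′ avoids′ → bound n A′ simple′ (weaker A′ avoids′)
  from : IsForb m r F′ N → IsForb m r F N
  from ((A , simple , avoids) , bound) =
    (A , simple , weaker A avoids) , λ n A′ simple′ avoids′ →
      let (A″ , simple″ , avoids″) = trade A′ simple′ avoids′ in bound n A″ simple″ avoids″

lemma6p1 : (r m a b c d : ℕ) → 3 < r → 2 ≤ m → 1 ≤ b → 1 ≤ c →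
    (r ∸ 2) ^ (m ∸ 2) ≥ 2 * ((b ⊔ c) ∸ 1) →
    ∀ (N : ℕ) → IsForb m r (Fmat a b c d) N ⇔ IsForb m r (Fmat a (b ⊓ c) (b ⊓ c) d) N
lemma6p1 (suc (suc q)) (suc (suc L)) a b c d (s≤s (s≤s _)) (s≤s (s≤s _)) 1≤b 1≤c room =
  isForb-⇔ (λ A → avoids-min A) rewrite-matrix
  where
  rewrite-matrix : ∀ {n} (A : Matrix (2 + L) n (2 + q)) → Simple A → Avoids A (Fmat a b c d) →
    Σ (Matrix (2 + L) n (2 + q)) λ A′ → Simple A′ × Avoids A′ (Fmat a (b ⊓ c) (b ⊓ c) d)
  rewrite-matrix A simple avoids = A′ , A′-simple , A′-avoids
    where open Rewrite (⊓-glb 1≤b 1≤c) room A simple avoids
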